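{- For every term $t\in T$ and every $f\in G_{\mathtt{ALD}}$ such that $t\cdot f$ is defined, $\mathcal{C}(t\cdot f)\sim\mathcal{C}(t)\bullet\mathrm{sh}_0(f)$.
   Context: $T$ is the set of terms built from the single variable $x$ using binary operation symbols $*$ and $\circ$. Addresses are words over $\{0,1\}$, $t/\alpha$ the subterm at $\alpha$. Partial operators: $\Sigma^+_\alpha$ is defined on $t$ iff $t/\alpha=t_1*(t_2\,\square\,t_3)$ with $\square\in\{*,\circ\}$ and replaces this subterm by $(t_1*t_2)\,\square\,(t_1*t_3)$; $A^+_\alpha$ is defined iff $t/\alpha=t_1*(t_2*t_3)$ and replaces it by $(t_1\circ t_2)*t_3$; $\Sigma^-_\alpha,A^-_\alpha$ are their inverses. $G_{\mathtt{ALD}}$ is the monoid of partial operators generated by these under $f\bullet g$ = "first $f$, then $g$"; $t\cdot f$ is the image of $t$; $f^{ -1}$ is the inverse partial map. For a partial operator $f$ and $i\in\{0,1\}$, $\mathrm{sh}_i(f)$ applies $f$ to the subterm $t/i$ of its argument. $\mathcal{C}:T\to G_{\mathtt{ALD}}$ is defined by $\mathcal{C}(x)=\mathrm{id}$, $\mathcal{C}(t_1*t_2)=\mathcal{C}(t_1)\bullet\mathrm{sh}_1(\mathcal{C}(t_2))\bullet\Sigma^+_\varepsilon\bullet\mathrm{sh}_1(\mathcal{C}(t_1))^{ -1}$, $\mathcal{C}(t_1\circ t_2)=\mathcal{C}(t_1)\bullet\mathrm{sh}_1(\mathcal{C}(t_2))\bullet A^+_\varepsilon$. For partial maps $f,g$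 on terms, $f\sim g$ means there exists at least one term on which both are defined and take the same value. -}

module Defs where

open import Data.Bool using (Bool; true; false; _∧_; if_then_else_)
open import Data.List using (List; []; _∷_)
open import Data.Maybe using (Maybe; just; nothing; _>>=_)
open import Data.Product using (∃; _×_; _,_)
open import Relation.Binary.PropositionalEquality using (_≡_)

data Op : Set where
  star circ : Op

data Term : Set where
  x   : Term
  bin : Op → Term → Term → Term

_*_ : Term → Term → Term
t₁ * t₂ = bin star t₁ t₂

_∘_ : Term → Term → Term
t₁ ∘ t₂ = bin circ t₁ t₂

eqOp : Op → Op → Bool
eqOp star star = true
eqOp circ circ = true
eqOp _    _    = false

eqTerm : Term → Term → Bool
eqTerm x x = true
eqTerm (bin o a b) (bin o' a' b') = eqOp o o' ∧ (eqTerm a a' ∧ eqTerm b b')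
eqTerm _ _ = false

data Bit : Set where
  b0 b1 : Bit

Addr : Set
Addr = List Bit

PMap : Set
PMap = Term → Maybe Term

_•_ : PMap → PMap → PMap
(f • g) t = f t >>= g

idP : PMap
idP t = just t

sh : Bit → PMap → PMap
sh _  f x = nothing
sh b0 f (bin o t₁ t₂) = f t₁ >>= λ s → just (bin o s t₂)
sh b1 f (bin o t₁ t₂) = f t₂ >>= λ s → just (bin o t₁ s)

at : Addr → PMap → PMap
at []      f = f
at (i ∷ α) f = sh i (at α f)

Σ⁺root : PMap
Σ⁺root (bin star t₁ (bin o t₂ t₃)) = just (bin o (t₁ * t₂) (t₁ * t₃))
Σ⁺root _ = nothing

Σ⁻root : PMap
Σ⁻root (bin o (bin star t₁ t₂) (bin star t₁' t₃)) =
  if eqTerm t₁ t₁' then just (t₁ * bin o t₂ t₃) else nothing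
Σ⁻root _ = nothing

A⁺root : PMap
A⁺root (bin star t₁ (bin star t₂ t₃)) = just ((t₁ ∘ t₂) * t₃)
A⁺root _ = nothing

A⁻root : PMap
A⁻root (bin star (bin circ t₁ t₂) t₃) = just (t₁ * (t₂ * t₃))
A⁻root _ = nothing

data Gen : Set where
  Σ⁺ Σ⁻ A⁺ A⁻ : Addr → Gen

⟦_⟧g : Gen → PMap
⟦ Σ⁺ α ⟧g = at α Σ⁺root
⟦ Σ⁻ α ⟧g = at α Σ⁻root
⟦ A⁺ α ⟧g = at α A⁺root
⟦ A⁻ α ⟧g = at α A⁻root

-- Elements of G_ALD are exactly the partial maps ⟦ w ⟧ for words w of
-- generators (the empty word giving the identity).
⟦_⟧ : List Gen → PMap
⟦ [] ⟧    = idP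
⟦ g ∷ w ⟧ = ⟦ g ⟧g • ⟦ w ⟧

-- Operator expressions (to express inverses of partial maps such as
-- sh_1(C(t))⁻¹): each expression has a forward and an inverse semantics.

data Expr : Set where
  gen  : Gen → Expr
  idE  : Expr
  _•E_ : Expr → Expr → Expr
  shE  : Bit → Expr → Expr
  invE : Expr → Expr

invG : Gen → Gen
invG (Σ⁺ α) = Σ⁻ α
invG (Σ⁻ α) = Σ⁺ α
invG (A⁺ α) = A⁻ α
invG (A⁻ α) = A⁺ α

fwd bwd : Expr → PMap
fwd (gen g)    = ⟦ g ⟧g
fwd idE        = idP
fwd (e •E e')  = fwd e • fwd e'
fwd (shE i e)  = sh i (fwd e)
fwd (invE e)   = bwd e
bwd (gen g)    = ⟦ invG g ⟧g
bwd idE        = idP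
bwd (e •E e')  = bwd e' • bwd e
bwd (shE i e)  = sh i (bwd e)
bwd (invE e)   = fwd e

Cexpr : Term → Expr
Cexpr x = idE
Cexpr (bin star t₁ t₂) =
  ((Cexpr t₁ •E shE b1 (Cexpr t₂)) •E gen (Σ⁺ [])) •E invE (shE b1 (Cexpr t₁))
Cexpr (bin circ t₁ t₂) =
  (Cexpr t₁ •E shE b1 (Cexpr t₂)) •E gen (A⁺ [])

𝒞 : Term → PMap
𝒞 t = fwd (Cexpr t)

_∼_ : PMap → PMap → Set
f ∼ g = ∃ λ u → ∃ λ v → (f u ≡ just v) × (g u ≡ just v)

-- Evaluating a term in ℕ with x = 1, a * b = b and a ∘ b = a + b gives its weight ρ; this
-- model satisfies the identities behind Σ and A, so every element of G_ALD preserves ρ.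
-- On the right vines x^[n] = x * (x * ⋯ (x * x)) with n stars, 𝒞 t sends x^[ρ t + n] to
-- t * x^[n] whenever n ≥ δ t. Hence if t · f = s, both 𝒞 s and 𝒞 t • sh₀(f) send
-- x^[ρ t + δ t + δ s] to s * x^[δ t + δ s].
module Submission where

open import Defs
open import Data.List using (List; []; _∷_)
open import Data.Maybe using (just)
open import Data.Bool using (true; false)
open import Data.Nat using (ℕ; zero; suc; _+_; _≤_; s≤s)
open import Data.Nat.Properties
  using (+-assoc; +-commutativeSemigroup; m≤m+n; m≤n+m; m+n≤o⇒m≤o; m+n≤o⇒n≤o; m≤n⇒m≤o+n)
open import Algebra.Properties.CommutativeSemigroup +-commutativeSemigroup using (x∙yz≈y∙xz)
open import Data.Product using (∃-syntax; _×_; _,_)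
open import Relation.Binary.PropositionalEquality
  using (_≡_; refl; sym; trans; cong; cong₂; subst)

eqOp-refl : ∀ o → eqOp o o ≡ true
eqOp-refl star = refl
eqOp-refl circ = refl

eqTerm-refl : ∀ t → eqTerm t t ≡ true
eqTerm-refl x = refl
eqTerm-refl (bin o a b) rewrite eqOp-refl o | eqTerm-refl a | eqTerm-refl b = refl

eqOp-sound : ∀ {o o'} → eqOp o o' ≡ true → o ≡ o'
eqOp-sound {star} {star} _ = refl
eqOp-sound {circ} {circ} _ = refl

eqTerm-sound : ∀ a b → eqTerm a b ≡ true → a ≡ b
eqTerm-sound x x _ = refl
eqTerm-sound (bin o a b) (bin o' a' b') eq
  with eqOp o o' in o≡o' | eqTerm a a' in a≡a' | eqTerm b b' in b≡b'
... | true | true | true =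
  trans (cong (λ p → bin p a b) (eqOp-sound o≡o'))
        (cong₂ (bin o') (eqTerm-sound a a' a≡a') (eqTerm-sound b b' b≡b'))

_InvertedBy_ : PMap → PMap → Set
f InvertedBy g = ∀ u {v} → f u ≡ just v → g v ≡ just u

•-just : ∀ {f g : PMap} {u v} → f u ≡ just v → (f • g) u ≡ g v
•-just eq rewrite eq = refl

•-invertedBy : ∀ {f f' g g'} → f InvertedBy g → f' InvertedBy g' → (f • f') InvertedBy (g' • g)
•-invertedBy {f} {g = g} {g'} f⁻¹ f'⁻¹ u eq with f u in fu≡w
... | just w = trans (•-just {g'} {g} (f'⁻¹ w eq)) (f⁻¹ u fu≡w)

sh-invertedBy : ∀ i {f g} → f InvertedBy g → sh i f InvertedBy sh i g
sh-invertedBy b0 {f} f⁻¹ (bin o t₁ t₂) eq with f t₁ in ft₁≡s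
... | just s with refl ← eq rewrite f⁻¹ t₁ ft₁≡s = refl
sh-invertedBy b1 {f} f⁻¹ (bin o t₁ t₂) eq with f t₂ in ft₂≡s
... | just s with refl ← eq rewrite f⁻¹ t₂ ft₂≡s = refl

at-invertedBy : ∀ α {f g} → f InvertedBy g → at α f InvertedBy at α g
at-invertedBy []      f⁻¹ = f⁻¹
at-invertedBy (i ∷ α) f⁻¹ = sh-invertedBy i (at-invertedBy α f⁻¹)

Σ⁺root-invertedBy-Σ⁻root : Σ⁺root InvertedBy Σ⁻root
Σ⁺root-invertedBy-Σ⁻root (bin star t₁ (bin o t₂ t₃)) refl rewrite eqTerm-refl t₁ = refl

Σ⁻root-invertedBy-Σ⁺root : Σ⁻root InvertedBy Σ⁺root
Σ⁻root-invertedBy-Σ⁺root (bin o (bin star t₁ t₂) (bin star t₁' t₃)) eq with eqTerm t₁ t₁' in t₁≡t₁'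
... | true with refl ← eq with refl ← eqTerm-sound t₁ t₁' t₁≡t₁' = refl

A⁺root-invertedBy-A⁻root : A⁺root InvertedBy A⁻root
A⁺root-invertedBy-A⁻root (bin star t₁ (bin star t₂ t₃)) refl = refl

A⁻root-invertedBy-A⁺root : A⁻root InvertedBy A⁺root
A⁻root-invertedBy-A⁺root (bin star (bin circ t₁ t₂) t₃) refl = refl

gen-invertedBy-invG : ∀ g → ⟦ g ⟧g InvertedBy ⟦ invG g ⟧g
gen-invertedBy-invG (Σ⁺ α) = at-invertedBy α Σ⁺root-invertedBy-Σ⁻root
gen-invertedBy-invG (Σ⁻ α) = at-invertedBy α Σ⁻root-invertedBy-Σ⁺root
gen-invertedBy-invG (A⁺ α) = at-invertedBy α A⁺root-invertedBy-A⁻root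
gen-invertedBy-invG (A⁻ α) = at-invertedBy α A⁻root-invertedBy-A⁺root

invG-invertedBy-gen : ∀ g → ⟦ invG g ⟧g InvertedBy ⟦ g ⟧g
invG-invertedBy-gen (Σ⁺ α) = gen-invertedBy-invG (Σ⁻ α)
invG-invertedBy-gen (Σ⁻ α) = gen-invertedBy-invG (Σ⁺ α)
invG-invertedBy-gen (A⁺ α) = gen-invertedBy-invG (A⁻ α)
invG-invertedBy-gen (A⁻ α) = gen-invertedBy-invG (A⁺ α)

fwd-invertedBy-bwd : ∀ e → fwd e InvertedBy bwd e
bwd-invertedBy-fwd : ∀ e → bwd e InvertedBy fwd e

fwd-invertedBy-bwd (gen g)   = gen-invertedBy-invG g
fwd-invertedBy-bwd idE       = λ _ → sym
fwd-invertedBy-bwd (e •E e') = •-invertedBy (fwd-invertedBy-bwd e) (fwd-invertedBy-bwd e')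
fwd-invertedBy-bwd (shE i e) = sh-invertedBy i (fwd-invertedBy-bwd e)
fwd-invertedBy-bwd (invE e)  = bwd-invertedBy-fwd e

bwd-invertedBy-fwd (gen g)   = invG-invertedBy-gen g
bwd-invertedBy-fwd idE       = λ _ → sym
bwd-invertedBy-fwd (e •E e') = •-invertedBy (bwd-invertedBy-fwd e') (bwd-invertedBy-fwd e)
bwd-invertedBy-fwd (shE i e) = sh-invertedBy i (bwd-invertedBy-fwd e)
bwd-invertedBy-fwd (invE e)  = fwd-invertedBy-bwd e

ρ : Term → ℕ
ρ x              = 1
ρ (bin star a b) = ρ b
ρ (bin circ a b) = ρ a + ρ b

Invariant : PMap → Set
Invariant f = ∀ u {v} → f u ≡ just v → ρ v ≡ ρ u

invertedBy-invariant : ∀ {f g} → f InvertedBy g → Invariant g → Invariant f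
invertedBy-invariant f⁻¹ g-inv u fu≡v = sym (g-inv _ (f⁻¹ u fu≡v))

•-invariant : ∀ {f g} → Invariant f → Invariant g → Invariant (f • g)
•-invariant {f} f-inv g-inv u eq with f u in fu≡w
... | just w = trans (g-inv w eq) (f-inv u fu≡w)

sh-invariant : ∀ i {f} → Invariant f → Invariant (sh i f)
sh-invariant b0 {f} f-inv (bin o t₁ t₂) eq with f t₁ in ft₁≡s
sh-invariant b0 f-inv (bin star t₁ t₂) refl | just s = refl
sh-invariant b0 f-inv (bin circ t₁ t₂) refl | just s = cong (_+ ρ t₂) (f-inv t₁ ft₁≡s)
sh-invariant b1 {f} f-inv (bin o t₁ t₂) eq with f t₂ in ft₂≡s
sh-invariant b1 f-inv (bin star t₁ t₂) refl | just s = f-inv t₂ ft₂≡s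
sh-invariant b1 f-inv (bin circ t₁ t₂) refl | just s = cong (ρ t₁ +_) (f-inv t₂ ft₂≡s)

at-invariant : ∀ α {f} → Invariant f → Invariant (at α f)
at-invariant []      f-inv = f-inv
at-invariant (i ∷ α) f-inv = sh-invariant i (at-invariant α f-inv)

Σ⁺root-invariant : Invariant Σ⁺root
Σ⁺root-invariant (bin star t₁ (bin star t₂ t₃)) refl = refl
Σ⁺root-invariant (bin star t₁ (bin circ t₂ t₃)) refl = refl

A⁺root-invariant : Invariant A⁺root
A⁺root-invariant (bin star t₁ (bin star t₂ t₃)) refl = refl

gen-invariant : ∀ g → Invariant ⟦ g ⟧g
gen-invariant (Σ⁺ α) = at-invariant α Σ⁺root-invariant
gen-invariant (Σ⁻ α) = at-invariant α (invertedBy-invariant Σ⁻root-invertedBy-Σ⁺root Σ⁺root-invariant)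
gen-invariant (A⁺ α) = at-invariant α A⁺root-invariant
gen-invariant (A⁻ α) = at-invariant α (invertedBy-invariant A⁻root-invertedBy-A⁺root A⁺root-invariant)

word-invariant : ∀ w → Invariant ⟦ w ⟧
word-invariant []      _ refl = refl
word-invariant (g ∷ w) = •-invariant (gen-invariant g) (word-invariant w)

δ : Term → ℕ
δ x              = 0
δ (bin star a b) = ρ a + (δ a + δ b)
δ (bin circ a b) = δ a + δ b

vine : ℕ → Term
vine zero    = x
vine (suc n) = x * vine n

m+n≤o⇒∃[k]o≡m+k×n≤k : ∀ m {n o} → m + n ≤ o → ∃[ k ] o ≡ m + k × n ≤ k
m+n≤o⇒∃[k]o≡m+k×n≤k zero    n≤o = _ , refl , n≤o
m+n≤o⇒∃[k]o≡m+k×n≤k (suc m) (s≤s m+n≤o) with m+n≤o⇒∃[k]o≡m+k×n≤k m m+n≤o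
... | k , refl , n≤k = k , refl , n≤k

𝒞-vine : ∀ t {n} → δ t ≤ n → 𝒞 t (vine (ρ t + n)) ≡ just (t * vine n)
𝒞-vine x _ = refl
𝒞-vine (bin circ t₁ t₂) {n} δ₁+δ₂≤n
  rewrite +-assoc (ρ t₁) (ρ t₂) n
        | 𝒞-vine t₁ (m≤n⇒m≤o+n (ρ t₂) (m+n≤o⇒m≤o (δ t₁) δ₁+δ₂≤n))
        | 𝒞-vine t₂ (m+n≤o⇒n≤o (δ t₁) δ₁+δ₂≤n) = refl
𝒞-vine (bin star t₁ t₂) δ≤n with m+n≤o⇒∃[k]o≡m+k×n≤k (ρ t₁) δ≤n
... | k , refl , δ₁+δ₂≤k with m+n≤o⇒m≤o (δ t₁) δ₁+δ₂≤k
... | δ₁≤k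
  rewrite x∙yz≈y∙xz (ρ t₂) (ρ t₁) k
        | 𝒞-vine t₁ (m≤n⇒m≤o+n (ρ t₂) δ₁≤k)
        | 𝒞-vine t₂ (m+n≤o⇒n≤o (δ t₁) δ₁+δ₂≤k)
        | fwd-invertedBy-bwd (Cexpr t₁) _ (𝒞-vine t₁ δ₁≤k) = refl

lemma3p5 : (t : Term) (w : List Gen) (s : Term) → ⟦ w ⟧ t ≡ just s →
           𝒞 s ∼ (𝒞 t • sh b0 ⟦ w ⟧)
lemma3p5 t w s w[t]≡s = vine (ρ t + n) , s * vine n , 𝒞s[vine] , 𝒞t•sh₀w[vine]
  where
  n : ℕ
  n = δ t + δ s

  𝒞s[vine] : 𝒞 s (vine (ρ t + n)) ≡ just (s * vine n)
  𝒞s[vine] = subst (λ r → 𝒞 s (vine (r + n)) ≡ just (s * vine n))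
                   (word-invariant w t w[t]≡s)
                   (𝒞-vine s (m≤n+m (δ s) (δ t)))

  𝒞t•sh₀w[vine] : (𝒞 t • sh b0 ⟦ w ⟧) (vine (ρ t + n)) ≡ just (s * vine n)
  𝒞t•sh₀w[vine] rewrite 𝒞-vine t (m≤m+n (δ t) (δ s)) | w[t]≡s = refl
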